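{- Let $V$ be a 2-dimensional vector space over a field $k$. Let $v_1,v_2,v_3\in V$ be nonzero and pairwise noncolinear, and let $\lambda_1,\lambda_2,\lambda_3\in V^*$ be nonzero with $\lambda_i(v_i)=0$ for each $i$. Then for all $a_1,a_2,a_3\in\mathrm{L}(V)$, $$\mathrm{tr}(a_1a_2a_3)=\mathrm{tr}(a_1)\mathrm{tr}(a_2)\mathrm{tr}(a_3)+\frac{1}{\lambda_1(v_2)\lambda_2(v_3)\lambda_3(v_1)}\sum_{\sigma\in S_3}\varepsilon(\sigma)\prod_{i=1,2,3}\lambda_{\sigma(123)(i)}\big(a_i(v_{\sigma(i)})\big).$$
   Context: $\mathrm{L}(V)$ is the space of linear maps $V\to V$. $\varepsilon(\sigma)$ is the signature of $\sigma\in S_3$; $(123)$ is the cycle $1\mapsto2\mapsto3\mapsto1$, and $\sigma(123)$ denotes the composite $\sigma\circ(123)$. (Under these hypotheses the denominator is nonzero.) -}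

module Defs where

open import Level using (Level; _⊔_) renaming (suc to lsuc)
open import Algebra.Bundles using (CommutativeRing)
open import Data.Fin using (Fin; zero; suc)
open import Data.Product using (_×_; _,_; ∃)
open import Data.Sum using (_⊎_)
open import Data.List using (List; []; _∷_)
open import Relation.Nullary using (¬_)

-- The inverse is a total operation
-- (its value at 0 is irrelevant), respecting the setoid equality.
record Field (c ℓ : Level) : Set (lsuc (c ⊔ ℓ)) where
  field
    commutativeRing : CommutativeRing c ℓ
  open CommutativeRing commutativeRing public
  field
    _⁻¹      : Carrier → Carrier
    ⁻¹-cong  : ∀ {x y} → x ≈ y → x ⁻¹ ≈ y ⁻¹
    0≉1      : ¬ (0# ≈ 1#)
    inverseʳ : ∀ x → ¬ (x ≈ 0#) → x * x ⁻¹ ≈ 1#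

Perm3 : Set
Perm3 = Fin 3 → Fin 3

-- the cycle (123) : 1 ↦ 2 ↦ 3 ↦ 1   (indices 0,1,2 stand for 1,2,3)
cyc123 : Perm3
cyc123 zero = suc zero
cyc123 (suc zero) = suc (suc zero)
cyc123 (suc (suc zero)) = zero

perm : Fin 3 → Fin 3 → Fin 3 → Perm3
perm x y z zero = x
perm x y z (suc zero) = y
perm x y z (suc (suc zero)) = z

i₁ i₂ i₃ : Fin 3
i₁ = zero
i₂ = suc zero
i₃ = suc (suc zero)

-- linear algebra on the 2-dimensional k-vector space V = k², with
-- dual V* = k² (row vectors) and L(V) = 2×2 matrices.
module TwoDim {c ℓ : Level} (K : Field c ℓ) where
  open Field K hiding (zero)

  data Sign : Set where
    plus minus : Sign

  sgn : Sign → Carrier → Carrier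
  sgn plus x = x
  sgn minus x = - x

  S₃ : List (Sign × Perm3)
  S₃ = (plus  , perm i₁ i₂ i₃)
     ∷ (minus , perm i₂ i₁ i₃)
     ∷ (minus , perm i₁ i₃ i₂)
     ∷ (minus , perm i₃ i₂ i₁)
     ∷ (plus  , perm i₂ i₃ i₁)
     ∷ (plus  , perm i₃ i₁ i₂)
     ∷ []

  sumList : List (Sign × Perm3) → (Perm3 → Carrier) → Carrier
  sumList [] f = 0#
  sumList ((s , σ) ∷ ps) f = sgn s (f σ) + sumList ps f

  V : Set c
  V = Carrier × Carrier

  _≈V_ : V → V → Set ℓ
  (x₁ , x₂) ≈V (y₁ , y₂) = (x₁ ≈ y₁) × (x₂ ≈ y₂)

  0V : V
  0V = (0# , 0#)

  _•_ : Carrier → V → V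
  a • (x₁ , x₂) = (a * x₁ , a * x₂)

  _+V_ : V → V → V
  (x₁ , x₂) +V (y₁ , y₂) = (x₁ + y₁ , x₂ + y₂)

  Colinear : V → V → Set (c ⊔ ℓ)
  Colinear u w = ∃ λ α → ∃ λ β →
    (¬ (α ≈ 0#) ⊎ ¬ (β ≈ 0#)) × ((α • u) +V (β • w)) ≈V 0V

  -- dual space V*: a linear form is given by its values (l₁ , l₂) on the
  -- standard basis; ⟪ λ , v ⟫ = λ(v)
  V* : Set c
  V* = Carrier × Carrier

  ⟪_,_⟫ : V* → V → Carrier
  ⟪ (l₁ , l₂) , (x₁ , x₂) ⟫ = l₁ * x₁ + l₂ * x₂

  0V* : V*
  0V* = (0# , 0#)

  _≈V*_ : V* → V* → Set ℓ
  _≈V*_ = _≈V_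

  -- L(V): 2×2 matrices ((a₁₁ , a₁₂) , (a₂₁ , a₂₂)) w.r.t. the standard basis
  L : Set c
  L = (Carrier × Carrier) × (Carrier × Carrier)

  _⟨$⟩_ : L → V → V
  ((a₁₁ , a₁₂) , (a₂₁ , a₂₂)) ⟨$⟩ (x₁ , x₂) =
    (a₁₁ * x₁ + a₁₂ * x₂ , a₂₁ * x₁ + a₂₂ * x₂)

  _∘L_ : L → L → L
  ((a₁₁ , a₁₂) , (a₂₁ , a₂₂)) ∘L ((b₁₁ , b₁₂) , (b₂₁ , b₂₂)) =
    ( (a₁₁ * b₁₁ + a₁₂ * b₂₁ , a₁₁ * b₁₂ + a₁₂ * b₂₂)
    , (a₂₁ * b₁₁ + a₂₂ * b₂₁ , a₂₁ * b₁₂ + a₂₂ * b₂₂) )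

  tr : L → Carrier
  tr ((a₁₁ , _) , (_ , a₂₂)) = a₁₁ + a₂₂

  term : (Fin 3 → V) → (Fin 3 → V*) → (Fin 3 → L) → Perm3 → Carrier
  term v λs a σ =
    ⟪ λs (σ (cyc123 i₁)) , a i₁ ⟨$⟩ v (σ i₁) ⟫ *
    (⟪ λs (σ (cyc123 i₂)) , a i₂ ⟨$⟩ v (σ i₂) ⟫ *
     ⟪ λs (σ (cyc123 i₃)) , a i₃ ⟨$⟩ v (σ i₃) ⟫)

{-# OPTIONS --safe #-}
module Submission where

-- In dimension two a linear form vanishing on a nonzero vector v is a multiple of
-- δ v = det(v, -). With indices mod 3, noncolinearity makes det(vₖ, vₖ₊₁) invertible,
-- so λₖ = rₖ δ vₖ with rₖ = λₖ(vₖ₊₁) / det(vₖ, vₖ₊₁); and λₖ(vₖ₊₁) ≠ 0, since otherwise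
-- rₖ = 0 and λₖ = 0. After this substitution the signed sum and the denominator
-- λ₁(v₂)λ₂(v₃)λ₃(v₁) are polynomials in the rₖ and in the coordinates of the vₖ and aᵢ,
-- and the sum equals the denominator times tr(a₁a₂a₃) − tr a₁ tr a₂ tr a₃ as polynomials.
-- Dividing by the nonzero denominator gives the formula.

open import Defs
open import Level using (Level)
open import Algebra.Bundles using (CommutativeRing)
open import Algebra.Solver.Ring.AlmostCommutativeRing
  using (fromCommutativeRing; _-Raw-AlmostCommutative⟶_)
open import Data.Fin.Base using (Fin; zero; suc)
open import Data.Integer.Base as ℤ using (ℤ; 0ℤ; +_; -[1+_]; _◃_; sign; ∣_∣; +-*-rawRing)
import Data.Integer.Properties as ℤ
import Data.List.Base as List
open import Data.Maybe.Base as Maybe using (Maybe)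
open import Data.Nat.Base as ℕ using (ℕ; zero; suc)
import Data.Nat.Properties as ℕ
open import Data.Product.Base using (_,_; proj₁; proj₂)
import Data.Sign.Base as Sign
open import Data.Sum.Base using (inj₂)
open import Data.Vec.Functional using (_∷_; [])
open import Function.Base using (_∘_)
open import Relation.Binary.Consequences using (dec⇒weaklyDec)
open import Relation.Binary.PropositionalEquality as ≡ using (_≡_)
open import Relation.Nullary.Negation using (¬_)

-- Over an arbitrary commutative ring the library's ring solvers either use natural
-- coefficients, which cannot cancel x - x, or need a zero test in the ring itself;
-- integer coefficients, mapped into the ring by fromℤ, need neither.
module IntegerCoefficients {c ℓ : Level} (R : CommutativeRing c ℓ) where
  open CommutativeRing R
  open import Algebra.Properties.Ring ring
    using (-0#≈0#; -‿involutive; -‿+-comm; xyx⁻¹≈y; -‿distribˡ-*; -‿distribʳ-*)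
  open import Algebra.Properties.Semiring.Mult semiring using (_×_; ×-homo-+; ×1-homo-*)
  open import Relation.Binary.Reasoning.Setoid setoid

  signed : Sign.Sign → Carrier → Carrier
  signed Sign.+ x = x
  signed Sign.- x = - x

  fromℤ : ℤ → Carrier
  fromℤ i = signed (sign i) (∣ i ∣ × 1#)

  signed-cong : ∀ s {x y} → x ≈ y → signed s x ≈ signed s y
  signed-cong Sign.+ x≈y = x≈y
  signed-cong Sign.- x≈y = -‿cong x≈y

  signed-* : ∀ s t x y → signed (s Sign.* t) (x * y) ≈ signed s x * signed t y
  signed-* Sign.+ Sign.+ x y = refl
  signed-* Sign.+ Sign.- x y = -‿distribʳ-* x y
  signed-* Sign.- Sign.+ x y = -‿distribˡ-* x y
  signed-* Sign.- Sign.- x y = begin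
    x * y        ≈⟨ -‿involutive (x * y) ⟨
    - - (x * y)  ≈⟨ -‿cong (-‿distribʳ-* x y) ⟩
    - (x * - y)  ≈⟨ -‿distribˡ-* x (- y) ⟩
    - x * - y    ∎

  fromℤ-◃ : ∀ s n → fromℤ (s ◃ n) ≈ signed s (n × 1#)
  fromℤ-◃ Sign.+ zero    = refl
  fromℤ-◃ Sign.- zero    = sym -0#≈0#
  fromℤ-◃ Sign.+ (suc n) = refl
  fromℤ-◃ Sign.- (suc n) = refl

  fromℤ-⊖ : ∀ m n → fromℤ (m ℤ.⊖ n) ≈ m × 1# - n × 1#
  fromℤ-⊖ m       zero    = sym (trans (+-congˡ -0#≈0#) (+-identityʳ _))
  fromℤ-⊖ zero    (suc n) = sym (+-identityˡ _)
  fromℤ-⊖ (suc m) (suc n) = begin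
    fromℤ (suc m ℤ.⊖ suc n)       ≡⟨ ≡.cong fromℤ (ℤ.[1+m]⊖[1+n]≡m⊖n m n) ⟩
    fromℤ (m ℤ.⊖ n)               ≈⟨ fromℤ-⊖ m n ⟩
    x - y                         ≈⟨ +-congʳ (xyx⁻¹≈y 1# x) ⟨
    1# + x - 1# - y               ≈⟨ +-assoc (1# + x) (- 1#) (- y) ⟩
    (1# + x) + (- 1# - y)         ≈⟨ +-congˡ (-‿+-comm 1# y) ⟩
    (1# + x) - (1# + y)           ∎
    where
    x y : Carrier
    x = m × 1#
    y = n × 1#

  +-homo : ∀ i j → fromℤ (i ℤ.+ j) ≈ fromℤ i + fromℤ j
  +-homo -[1+ m ] -[1+ n ] = begin
    - (suc (suc (m ℕ.+ n)) × 1#)  ≡⟨ ≡.cong (λ k → - (suc k × 1#)) (ℕ.+-suc m n) ⟨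
    - ((suc m ℕ.+ suc n) × 1#)    ≈⟨ -‿cong (×-homo-+ 1# (suc m) (suc n)) ⟩
    - (suc m × 1# + suc n × 1#)   ≈⟨ -‿+-comm _ _ ⟨
    - (suc m × 1#) - (suc n × 1#) ∎
  +-homo -[1+ m ] (+ n)    = trans (fromℤ-⊖ n (suc m)) (+-comm _ _)
  +-homo (+ m)    -[1+ n ] = fromℤ-⊖ m (suc n)
  +-homo (+ m)    (+ n)    = ×-homo-+ 1# m n

  *-homo : ∀ i j → fromℤ (i ℤ.* j) ≈ fromℤ i * fromℤ j
  *-homo i j = begin
    fromℤ (i ℤ.* j)                              ≡⟨⟩
    fromℤ (s ◃ ∣ i ∣ ℕ.* ∣ j ∣)                  ≈⟨ fromℤ-◃ s (∣ i ∣ ℕ.* ∣ j ∣) ⟩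
    signed s ((∣ i ∣ ℕ.* ∣ j ∣) × 1#)            ≈⟨ signed-cong s (×1-homo-* ∣ i ∣ ∣ j ∣) ⟩
    signed s (∣ i ∣ × 1# * ∣ j ∣ × 1#)           ≈⟨ signed-* (sign i) (sign j) _ _ ⟩
    fromℤ i * fromℤ j                            ∎
    where
    s : Sign.Sign
    s = sign i Sign.* sign j

  -‿homo : ∀ i → fromℤ (ℤ.- i) ≈ - fromℤ i
  -‿homo -[1+ n ]    = sym (-‿involutive _)
  -‿homo (+ zero)    = sym -0#≈0#
  -‿homo (+ (suc n)) = refl

  homomorphism : +-*-rawRing -Raw-AlmostCommutative⟶ fromCommutativeRing R
  homomorphism = record
    { ⟦_⟧    = fromℤ
    ; +-homo = +-homo
    ; *-homo = *-homo
    ; -‿homo = -‿homo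
    ; 0-homo = refl
    ; 1-homo = +-identityʳ 1#
    }

  coefficient≟ : ∀ i j → Maybe (fromℤ i ≈ fromℤ j)
  coefficient≟ i j = Maybe.map (reflexive ∘ ≡.cong fromℤ) (dec⇒weaklyDec ℤ._≟_ i j)

  open import Algebra.Solver.Ring +-*-rawRing (fromCommutativeRing R) homomorphism coefficient≟ public

cyc123-fixed-point-free : ∀ k → ¬ k ≡ cyc123 k
cyc123-fixed-point-free zero ()
cyc123-fixed-point-free (suc zero) ()
cyc123-fixed-point-free (suc (suc zero)) ()

module FieldProperties {c ℓ : Level} (K : Field c ℓ) where
  open Field K
  open IntegerCoefficients commutativeRing using (_:+_; _:*_; _:-_; _:=_; solve)
  open import Relation.Binary.Reasoning.Setoid setoid

  x*y≈z⇒x≈z*y⁻¹ : ∀ {x y z} → ¬ y ≈ 0# → x * y ≈ z → x ≈ z * y ⁻¹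
  x*y≈z⇒x≈z*y⁻¹ {x} {y} {z} y≉0 xy≈z = begin
    x               ≈⟨ *-identityʳ x ⟨
    x * 1#          ≈⟨ *-congˡ (inverseʳ y y≉0) ⟨
    x * (y * y ⁻¹)  ≈⟨ *-assoc x y (y ⁻¹) ⟨
    x * y * y ⁻¹    ≈⟨ *-congʳ xy≈z ⟩
    z * y ⁻¹        ∎

  *-preserves-≉0 : ∀ {x y} → ¬ x ≈ 0# → ¬ y ≈ 0# → ¬ x * y ≈ 0#
  *-preserves-≉0 {x} {y} x≉0 y≉0 xy≈0 =
    x≉0 (trans (x*y≈z⇒x≈z*y⁻¹ y≉0 xy≈0) (zeroˡ (y ⁻¹)))

  w≈z*[x-y]⇒x≈y+z⁻¹*w : ∀ {x y z w} → ¬ z ≈ 0# → w ≈ z * (x - y) → x ≈ y + z ⁻¹ * w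
  w≈z*[x-y]⇒x≈y+z⁻¹*w {x} {y} {z} {w} z≉0 w≈z[x-y] = sym (begin
    y + z ⁻¹ * w              ≈⟨ +-congˡ (*-congˡ w≈z[x-y]) ⟩
    y + z ⁻¹ * (z * (x - y))  ≈⟨ solve 4 (λ x y z z⁻¹ →
                                   y :+ z⁻¹ :* (z :* (x :- y)) := y :+ z :* z⁻¹ :* (x :- y))
                                 refl x y z (z ⁻¹) ⟩
    y + z * z ⁻¹ * (x - y)    ≈⟨ +-congˡ (*-congʳ (inverseʳ z z≉0)) ⟩
    y + 1# * (x - y)          ≈⟨ +-congˡ (*-identityˡ (x - y)) ⟩
    y + (x - y)               ≈⟨ solve 2 (λ x y → y :+ (x :- y) := x) refl x y ⟩
    x                         ∎)

module Plane {c ℓ : Level} (K : Field c ℓ) where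
  open Field K hiding (zero)
  open TwoDim K
  open FieldProperties K
  open import Data.Product.Base using (_×_)
  open IntegerCoefficients commutativeRing
    using (Polynomial; con; _:+_; _:*_; :-_; _:-_; _:=_; solve)
  open import Algebra.Properties.Ring ring using (-0#≈0#)
  open import Relation.Binary.Reasoning.Setoid setoid

  δ : V → V*
  δ (x , y) = (- y , x)

  det : V → V → Carrier
  det u w = ⟪ δ u , w ⟫

  cyclicProduct : (Fin 3 → V) → (Fin 3 → V*) → Carrier
  cyclicProduct v φ = ⟪ φ i₁ , v i₂ ⟫ * (⟪ φ i₂ , v i₃ ⟫ * ⟪ φ i₃ , v i₁ ⟫)

  traceDefect : (Fin 3 → L) → Carrier
  traceDefect a = tr (a i₁ ∘L (a i₂ ∘L a i₃)) - tr (a i₁) * (tr (a i₂) * tr (a i₃))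

  -- Which coordinate of u is nonzero cannot be decided, but each relation
  -- (- wᵢ) • u + uᵢ • w = 0 refutes uᵢ ≉ 0, and both refutations together contradict u ≉ 0.
  noncolinear⇒det≉0 : ∀ {u w} → ¬ u ≈V 0V → ¬ Colinear u w → ¬ det u w ≈ 0#
  noncolinear⇒det≉0 {u₁ , u₂} {w₁ , w₂} u≉0 noncolinear det≈0 =
    ¬¬u₁≈0 (λ u₁≈0 → ¬¬u₂≈0 (λ u₂≈0 → u≉0 (u₁≈0 , u₂≈0)))
    where
    ¬¬u₁≈0 : ¬ ¬ u₁ ≈ 0#
    ¬¬u₁≈0 u₁≉0 = noncolinear (- w₁ , u₁ , inj₂ u₁≉0 ,
      solve 2 (λ u₁ w₁ → :- w₁ :* u₁ :+ u₁ :* w₁ := con 0ℤ) refl u₁ w₁ ,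
      trans (solve 4 (λ u₁ u₂ w₁ w₂ → :- w₁ :* u₂ :+ u₁ :* w₂ := :- u₂ :* w₁ :+ u₁ :* w₂)
                     refl u₁ u₂ w₁ w₂)
            det≈0)
    ¬¬u₂≈0 : ¬ ¬ u₂ ≈ 0#
    ¬¬u₂≈0 u₂≉0 = noncolinear (- w₂ , u₂ , inj₂ u₂≉0 ,
      trans (solve 4 (λ u₁ u₂ w₁ w₂ → :- w₂ :* u₁ :+ u₂ :* w₁ := :- (:- u₂ :* w₁ :+ u₁ :* w₂))
                     refl u₁ u₂ w₁ w₂)
            (trans (-‿cong det≈0) -0#≈0#) ,
      solve 2 (λ u₂ w₂ → :- w₂ :* u₂ :+ u₂ :* w₂ := con 0ℤ) refl u₂ w₂)

  annihilator≈multiple-of-δ : ∀ φ v u → ⟪ φ , v ⟫ ≈ 0# → ¬ det v u ≈ 0# →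
                              φ ≈V* ((⟪ φ , u ⟫ * det v u ⁻¹) • δ v)
  annihilator≈multiple-of-δ (l₁ , l₂) (x , y) (u₁ , u₂) φv≈0 d≉0 =
    coordinate (solve 6 (λ l₁ l₂ x y u₁ u₂ →
                  l₁ :* (:- y :* u₁ :+ x :* u₂)
                  := (l₁ :* u₁ :+ l₂ :* u₂) :* (:- y) :+ u₂ :* (l₁ :* x :+ l₂ :* y))
                refl l₁ l₂ x y u₁ u₂) ,
    coordinate (solve 6 (λ l₁ l₂ x y u₁ u₂ →
                  l₂ :* (:- y :* u₁ :+ x :* u₂)
                  := (l₁ :* u₁ :+ l₂ :* u₂) :* x :+ :- u₁ :* (l₁ :* x :+ l₂ :* y))
                refl l₁ l₂ x y u₁ u₂)
    where
    φu φv d : Carrier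
    φu = ⟪ (l₁ , l₂) , (u₁ , u₂) ⟫
    φv = ⟪ (l₁ , l₂) , (x , y) ⟫
    d  = det (x , y) (u₁ , u₂)
    coordinate : ∀ {l w c} → l * d ≈ φu * w + c * φv → l ≈ φu * d ⁻¹ * w
    coordinate {l} {w} {c} ld≈ = begin
      l                        ≈⟨ x*y≈z⇒x≈z*y⁻¹ d≉0 ld≈ ⟩
      (φu * w + c * φv) * d ⁻¹ ≈⟨ *-congʳ (+-congˡ (*-congˡ φv≈0)) ⟩
      (φu * w + c * 0#) * d ⁻¹ ≈⟨ solve 4 (λ φu w c d⁻¹ →
                                    (φu :* w :+ c :* con 0ℤ) :* d⁻¹ := φu :* d⁻¹ :* w)
                                  refl φu w c (d ⁻¹) ⟩
      φu * d ⁻¹ * w            ∎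

  annihilator-pairing≉0 : ∀ φ v u → ⟪ φ , v ⟫ ≈ 0# → ¬ det v u ≈ 0# →
                          ¬ φ ≈V* 0V* → ¬ ⟪ φ , u ⟫ ≈ 0#
  annihilator-pairing≉0 φ v u φv≈0 d≉0 φ≉0 φu≈0 =
    φ≉0 (vanishes (proj₁ φ≈rδv) , vanishes (proj₂ φ≈rδv))
    where
    φ≈rδv : φ ≈V* ((⟪ φ , u ⟫ * det v u ⁻¹) • δ v)
    φ≈rδv = annihilator≈multiple-of-δ φ v u φv≈0 d≉0
    vanishes : ∀ {l w} → l ≈ ⟪ φ , u ⟫ * det v u ⁻¹ * w → l ≈ 0#
    vanishes {l} {w} l≈ = begin
      l                              ≈⟨ l≈ ⟩
      ⟪ φ , u ⟫ * det v u ⁻¹ * w     ≈⟨ *-congʳ (*-congʳ φu≈0) ⟩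
      0# * det v u ⁻¹ * w            ≈⟨ *-congʳ (zeroˡ (det v u ⁻¹)) ⟩
      0# * w                         ≈⟨ zeroˡ w ⟩
      0#                             ∎

  pairing-congˡ : ∀ {φ ψ} w → φ ≈V* ψ → ⟪ φ , w ⟫ ≈ ⟪ ψ , w ⟫
  pairing-congˡ w (φ₁≈ψ₁ , φ₂≈ψ₂) = +-cong (*-congʳ φ₁≈ψ₁) (*-congʳ φ₂≈ψ₂)

  cyclicProduct-cong : ∀ v {φ ψ} → (∀ k → φ k ≈V* ψ k) → cyclicProduct v φ ≈ cyclicProduct v ψ
  cyclicProduct-cong v φ≈ψ =
    *-cong (pairing-congˡ (v i₂) (φ≈ψ i₁))
      (*-cong (pairing-congˡ (v i₃) (φ≈ψ i₂)) (pairing-congˡ (v i₁) (φ≈ψ i₃)))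

  term-cong : ∀ v {φ ψ} a σ → (∀ k → φ k ≈V* ψ k) → term v φ a σ ≈ term v ψ a σ
  term-cong v {φ} {ψ} a σ φ≈ψ = *-cong (factor i₁) (*-cong (factor i₂) (factor i₃))
    where
    factor : ∀ i → ⟪ φ (σ (cyc123 i)) , a i ⟨$⟩ v (σ i) ⟫
                 ≈ ⟪ ψ (σ (cyc123 i)) , a i ⟨$⟩ v (σ i) ⟫
    factor i = pairing-congˡ (a i ⟨$⟩ v (σ i)) (φ≈ψ (σ (cyc123 i)))

  sgn-cong : ∀ s {x y} → x ≈ y → sgn s x ≈ sgn s y
  sgn-cong plus  x≈y = x≈y
  sgn-cong minus x≈y = -‿cong x≈y

  sumList-cong : ∀ ps {f g} → (∀ σ → f σ ≈ g σ) → sumList ps f ≈ sumList ps g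
  sumList-cong List.[]              _   = refl
  sumList-cong ((s , σ) List.∷ ps) f≈g = +-cong (sgn-cong s (f≈g σ)) (sumList-cong ps f≈g)

  -- The formulas of TwoDim over solver expressions. Their semantics unfold definitionally
  -- to the formulas of TwoDim, so solve proves statements phrased with term and sumList.
  module Expressions {n : ℕ} where
    Vₑ Lₑ : Set
    Vₑ = Polynomial n × Polynomial n
    Lₑ = Vₑ × Vₑ

    ⟪_,_⟫ₑ : Vₑ → Vₑ → Polynomial n
    ⟪ (l₁ , l₂) , (x₁ , x₂) ⟫ₑ = l₁ :* x₁ :+ l₂ :* x₂

    _•ₑ_ : Polynomial n → Vₑ → Vₑ
    a •ₑ (x₁ , x₂) = (a :* x₁ , a :* x₂)

    δₑ : Vₑ → Vₑ
    δₑ (x , y) = (:- y , x)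

    _⟨$⟩ₑ_ : Lₑ → Vₑ → Vₑ
    ((a₁₁ , a₁₂) , (a₂₁ , a₂₂)) ⟨$⟩ₑ (x₁ , x₂) =
      (a₁₁ :* x₁ :+ a₁₂ :* x₂ , a₂₁ :* x₁ :+ a₂₂ :* x₂)

    _∘ₑ_ : Lₑ → Lₑ → Lₑ
    ((a₁₁ , a₁₂) , (a₂₁ , a₂₂)) ∘ₑ ((b₁₁ , b₁₂) , (b₂₁ , b₂₂)) =
      ( (a₁₁ :* b₁₁ :+ a₁₂ :* b₂₁ , a₁₁ :* b₁₂ :+ a₁₂ :* b₂₂)
      , (a₂₁ :* b₁₁ :+ a₂₂ :* b₂₁ , a₂₁ :* b₁₂ :+ a₂₂ :* b₂₂) )

    trₑ : Lₑ → Polynomial n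
    trₑ ((a₁₁ , _) , (_ , a₂₂)) = a₁₁ :+ a₂₂

    sgnₑ : Sign → Polynomial n → Polynomial n
    sgnₑ plus  x = x
    sgnₑ minus x = :- x

    sumListₑ : List.List (Sign × Perm3) → (Perm3 → Polynomial n) → Polynomial n
    sumListₑ List.[]              _ = con 0ℤ
    sumListₑ ((s , σ) List.∷ ps) f = sgnₑ s (f σ) :+ sumListₑ ps f

    termₑ : (Fin 3 → Vₑ) → (Fin 3 → Vₑ) → (Fin 3 → Lₑ) → Perm3 → Polynomial n
    termₑ v φ a σ =
      ⟪ φ (σ (cyc123 i₁)) , a i₁ ⟨$⟩ₑ v (σ i₁) ⟫ₑ :*
      (⟪ φ (σ (cyc123 i₂)) , a i₂ ⟨$⟩ₑ v (σ i₂) ⟫ₑ :*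
       ⟪ φ (σ (cyc123 i₃)) , a i₃ ⟨$⟩ₑ v (σ i₃) ⟫ₑ)

    cyclicProductₑ : (Fin 3 → Vₑ) → (Fin 3 → Vₑ) → Polynomial n
    cyclicProductₑ v φ = ⟪ φ i₁ , v i₂ ⟫ₑ :* (⟪ φ i₂ , v i₃ ⟫ₑ :* ⟪ φ i₃ , v i₁ ⟫ₑ)

    traceDefectₑ : (Fin 3 → Lₑ) → Polynomial n
    traceDefectₑ a = trₑ (a i₁ ∘ₑ (a i₂ ∘ₑ a i₃)) :- trₑ (a i₁) :* (trₑ (a i₂) :* trₑ (a i₃))

    traceIdentityₑ : (Fin 3 → Vₑ) → (Fin 3 → Polynomial n) → (Fin 3 → Lₑ) →
                     Polynomial n × Polynomial n
    traceIdentityₑ v r a = sumListₑ S₃ (termₑ v φ a) := cyclicProductₑ v φ :* traceDefectₑ a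
      where
      φ : Fin 3 → Vₑ
      φ k = r k •ₑ δₑ (v k)

  trace-identity-for-multiples-of-δ :
    ∀ (v : Fin 3 → V) (r : Fin 3 → Carrier) (a : Fin 3 → L) →
    sumList S₃ (term v (λ k → r k • δ (v k)) a)
      ≈ cyclicProduct v (λ k → r k • δ (v k)) * traceDefect a
  trace-identity-for-multiples-of-δ v r a =
    solve 21
      (λ x₁ y₁ x₂ y₂ x₃ y₃ r₁ r₂ r₃ a₁ b₁ c₁ d₁ a₂ b₂ c₂ d₂ a₃ b₃ c₃ d₃ →
         traceIdentityₑ ((x₁ , y₁) ∷ (x₂ , y₂) ∷ (x₃ , y₃) ∷ [])
                        (r₁ ∷ r₂ ∷ r₃ ∷ [])
                        (((a₁ , b₁) , (c₁ , d₁)) ∷ ((a₂ , b₂) , (c₂ , d₂))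
                           ∷ ((a₃ , b₃) , (c₃ , d₃)) ∷ []))
      refl
      (x i₁) (y i₁) (x i₂) (y i₂) (x i₃) (y i₃) (r i₁) (r i₂) (r i₃)
      (a₁₁ i₁) (a₁₂ i₁) (a₂₁ i₁) (a₂₂ i₁)
      (a₁₁ i₂) (a₁₂ i₂) (a₂₁ i₂) (a₂₂ i₂)
      (a₁₁ i₃) (a₁₂ i₃) (a₂₁ i₃) (a₂₂ i₃)
    where
    open Expressions
    x y : Fin 3 → Carrier
    x = proj₁ ∘ v
    y = proj₂ ∘ v
    a₁₁ a₁₂ a₂₁ a₂₂ : Fin 3 → Carrier
    a₁₁ = proj₁ ∘ proj₁ ∘ a
    a₁₂ = proj₂ ∘ proj₁ ∘ a
    a₂₁ = proj₁ ∘ proj₂ ∘ a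
    a₂₂ = proj₂ ∘ proj₂ ∘ a

corollary5p1 : {c ℓ : Level} (K : Field c ℓ) →
    let open Field K
        open TwoDim K
    in (v : Fin 3 → V) (λs : Fin 3 → V*) →
       (∀ i → ¬ (v i ≈V 0V)) →
       (∀ i j → ¬ (i ≡ j) → ¬ Colinear (v i) (v j)) →
       (∀ i → ¬ (λs i ≈V* 0V*)) →
       (∀ i → ⟪ λs i , v i ⟫ ≈ 0#) →
       (a : Fin 3 → L) →
       tr (a i₁ ∘L (a i₂ ∘L a i₃))
         ≈ tr (a i₁) * (tr (a i₂) * tr (a i₃))
           + ((⟪ λs i₁ , v i₂ ⟫ * (⟪ λs i₂ , v i₃ ⟫ * ⟪ λs i₃ , v i₁ ⟫)) ⁻¹)
             * sumList S₃ (term v λs a)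
corollary5p1 K v λs v≉0 noncolinear λs≉0 λs-annihilate a =
  w≈z*[x-y]⇒x≈y+z⁻¹*w denominator≉0 (begin
    sumList S₃ (term v λs a)            ≈⟨ sumList-cong S₃ (λ σ → term-cong v a σ λs≈μ) ⟩
    sumList S₃ (term v μ a)             ≈⟨ trace-identity-for-multiples-of-δ v r a ⟩
    cyclicProduct v μ * traceDefect a   ≈⟨ *-congʳ (cyclicProduct-cong v λs≈μ) ⟨
    cyclicProduct v λs * traceDefect a  ∎)
  where
  open Field K
  open TwoDim K
  open FieldProperties K
  open Plane K
  open import Relation.Binary.Reasoning.Setoid setoid

  det≉0 : ∀ k → ¬ det (v k) (v (cyc123 k)) ≈ 0#
  det≉0 k = noncolinear⇒det≉0 (v≉0 k) (noncolinear k (cyc123 k) (cyc123-fixed-point-free k))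

  r : Fin 3 → Carrier
  r k = ⟪ λs k , v (cyc123 k) ⟫ * det (v k) (v (cyc123 k)) ⁻¹

  μ : Fin 3 → V*
  μ k = r k • δ (v k)

  λs≈μ : ∀ k → λs k ≈V* μ k
  λs≈μ k = annihilator≈multiple-of-δ (λs k) (v k) (v (cyc123 k)) (λs-annihilate k) (det≉0 k)

  pairing≉0 : ∀ k → ¬ ⟪ λs k , v (cyc123 k) ⟫ ≈ 0#
  pairing≉0 k =
    annihilator-pairing≉0 (λs k) (v k) (v (cyc123 k)) (λs-annihilate k) (det≉0 k) (λs≉0 k)

  denominator≉0 : ¬ cyclicProduct v λs ≈ 0#
  denominator≉0 = *-preserves-≉0 (pairing≉0 i₁) (*-preserves-≉0 (pairing≉0 i₂) (pairing≉0 i₃))
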